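{- Consider the synchronous singing protocol on a dynamic network. Suppose agent $v$ is incident to an edge that is not affected in the beginning of round $i+1$ nor in the beginning of round $i+2$ (i.e., in neither $A_{i+1}$ nor $A_{i+2}$). Then if $v$ is active in round $i+2$, $v$ is in state $\textsc{Un}^{\overline{\textsc{In}}}$ in round $i+2$ (state $\textsc{Un}$ with no neighbor in state $\textsc{In}$). Also, if $v$ has a neighbor $u$ that is in state $\textsc{Un}$ in round $i+2$, then $u$ was active in round $i$.
   Context: Agents are the vertices of an undirected communication graph; agents know nothing about the graph. Each agent is in one of three states $\{\textsc{Out},\textsc{In},\textsc{Un}\}$ and operates in synchronous rounds (all rounds start and end simultaneously; every note sung in a round is heard by all neighbors by the end of the round). An agent hears the union of notes sung by its neighbors (it detects presence of a note, not multiplicity). Singing protocol (one round, agent in state $s$): compute a fresh $\ell$-value by flipping a fair coin until the first $0$, $\ell$ = number of flips. If $s=\textsc{Out}$ sing nothing; if $s=\textsc{In}$ sing note $0$; if $s=\textsc{Un}$ sing notes $1,\dots,\ell$. All agents listen for note $0$; $\textsc{Un}$ agents also listen for note $\ell$. End of round: $\textsc{In}$ becomes $\textsc{Un}$ if it heard $0$, else stays $\textsc{In}$; $\textsc{Un}$ becomes $\textsc{Out}$ if it heard $0$, otherwise stays $\textsc{Un}$ if it heard note $\ell$ and becomes $\textsc{In}$ if not; $\textsc{Out}$ stays $\textsc{Out}$ if it heard $0$, else becomes $\textsc{Un}$. Dynamic networks: agents and edges may be inserted or deleted; all such changes are regarded as occurring at the beginning of a round; new agents start in arbitrary states. An agent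 that changes state arbitrarily or does not execute the protocol correctly at the end of round $i-1$ is modeled as being deleted and reinserted (with its edges) in its new state at the beginning of round $i$. An agent is changed in round $i$ if it is incident to an edge added or deleted at the beginning of round $i$. An edge is affected in round $i$ if one of its endpoints is at distance at most $2$ from an agent changed in round $i$; $A_i$ is the set of such edges. An agent is $\textsc{In}^{\overline{\textsc{In}}}$ in a round if it is $\textsc{In}$ and has no $\textsc{In}$ neighbor in that round. An agent is eliminated in round $i$ if it is $\textsc{In}^{\overline{\textsc{In}}}$ or adjacent to an $\textsc{In}^{\overline{\textsc{In}}}$ agent in round $i$; otherwise it is active. -}

module Defs where

open import Data.Nat using (ℕ; suc; _≤_; _+_)
open import Data.Fin using (Fin)
open import Data.Bool using (Bool; true; false)
open import Data.Product using (Σ; _×_; ∃)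
open import Data.Sum using (_⊎_)
open import Relation.Nullary using (¬_)
open import Relation.Binary.PropositionalEquality using (_≡_; _≢_)

data State : Set where
  Out In Un : State

-- The agents of the system are (a superset of) Fin n; an agent that is not
-- currently in the network is modelled as an isolated vertex.
-- A dynamic network: one simple undirected graph per round (the graph in
-- force during round i, i.e. after the changes at the beginning of round i).
DynGraph : ℕ → Set
DynGraph n = ℕ → Fin n → Fin n → Bool

Adj : ∀ {n} → DynGraph n → ℕ → Fin n → Fin n → Set
Adj G i a b = G i a b ≡ true

SimpleGraphs : ∀ {n} → DynGraph n → Set
SimpleGraphs {n} G = ∀ (i : ℕ) (a b : Fin n) →
  (Adj G i a b → Adj G i b a) × ¬ Adj G i a a

data Sings : State → ℕ → ℕ → Set where
  sing-in : ∀ {l} → Sings In l 0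
  sing-un : ∀ {l k} → 1 ≤ k → k ≤ l → Sings Un l k

Hears : ∀ {n} → DynGraph n → (ℕ → Fin n → State) → (ℕ → Fin n → ℕ) →
        ℕ → Fin n → ℕ → Set
Hears {n} G st ℓ i w k = Σ (Fin n) λ u → Adj G i w u × Sings (st i u) (ℓ i u) k

-- End-of-round transition, given whether note 0 (h0) and note ℓ (hl) were heard.
data Transition (h0 hl : Set) : State → State → Set where
  in-heard0   : h0 → Transition h0 hl In Un
  in-silent   : ¬ h0 → Transition h0 hl In In
  un-heard0   : h0 → Transition h0 hl Un Out
  un-heardℓ   : ¬ h0 → hl → Transition h0 hl Un Un
  un-silent   : ¬ h0 → ¬ hl → Transition h0 hl Un In
  out-heard0  : h0 → Transition h0 hl Out Out
  out-silent  : ¬ h0 → Transition h0 hl Out Un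

-- An execution: graphs G, states st i w (state of w in round i),
-- ℓ-values ℓ i w ≥ 1 drawn in round i (arbitrary outcomes of the coin flips),
-- and R i w : agent w is (modelled as) deleted and reinserted, in an arbitrary
-- state, at the beginning of round i.
record Execution (n : ℕ) : Set where
  field
    G      : DynGraph n
    simple : SimpleGraphs G
    st     : ℕ → Fin n → State
    ℓ      : ℕ → Fin n → ℕ
    ℓ≥1    : ∀ i w → 1 ≤ ℓ i w
    R      : ℕ → Fin n → Bool
    follows : ∀ i w → R (suc i) w ≡ false →
      Transition (Hears G st ℓ i w 0) (Hears G st ℓ i w (ℓ i w))
                 (st i w) (st (suc i) w)

module _ {n : ℕ} (X : Execution n) where
  open Execution X

  -- The edge {w,x} is added or deleted at the beginning of round i+1: either its
  -- presence differs between rounds i and i+1, or one endpoint is reinserted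
  -- (which deletes and re-adds all its edges).
  EdgeChangedAt : ℕ → Fin n → Fin n → Set
  EdgeChangedAt i w x =
    (G i w x ≢ G (suc i) w x) ⊎
    ((R (suc i) w ≡ true ⊎ R (suc i) x ≡ true) × (Adj G i w x ⊎ Adj G (suc i) w x))

  -- Agent w is changed in round i+1.
  ChangedIn : ℕ → Fin n → Set
  ChangedIn i w = Σ (Fin n) λ x → EdgeChangedAt i w x

  Dist≤2 : ℕ → Fin n → Fin n → Set
  Dist≤2 j a c = (a ≡ c) ⊎ Adj G j a c ⊎ (Σ (Fin n) λ d → Adj G j a d × Adj G j d c)

  -- The edge {a,b} belongs to A_{i+1} (affected in round i+1).
  AffectedIn : ℕ → Fin n → Fin n → Set
  AffectedIn i a b = Adj G (suc i) a b ×
    (Σ (Fin n) λ c → ChangedIn i c × (Dist≤2 (suc i) a c ⊎ Dist≤2 (suc i) b c))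

  InNoIn : ℕ → Fin n → Set
  InNoIn j w = st j w ≡ In × (∀ u → Adj G j w u → st j u ≢ In)

  UnNoIn : ℕ → Fin n → Set
  UnNoIn j w = st j w ≡ Un × (∀ u → Adj G j w u → st j u ≢ In)

  Eliminated : ℕ → Fin n → Set
  Eliminated j w = InNoIn j w ⊎ (Σ (Fin n) λ u → Adj G j w u × InNoIn j u)

  Active : ℕ → Fin n → Set
  Active j w = ¬ Eliminated j w

{-# OPTIONS --safe #-}
module Submission where

-- Two adjacent agents that both obey the protocol cannot both end a round In:
-- an In agent makes its neighbour hear note 0, and of two Un agents the one
-- with the smaller ℓ-value hears its own note from the other. Around an
-- unaffected edge nothing changes for two rounds, so every In agent within
-- distance 1 of v in rounds i+1 and i+2 has no In neighbour, and such an agent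
-- stays In. Both claims then follow by inverting the transitions of v and u.

open import Defs
open import Data.Nat using (ℕ; suc)
open import Data.Nat.Properties using (≤-total)
open import Data.Fin using (Fin)
open import Data.Bool using (false)
open import Data.Bool.Properties using (_≟_; ¬-not)
open import Data.Product using (Σ; _×_; _,_; proj₁; proj₂)
open import Data.Sum using (_⊎_; inj₁; inj₂)
open import Data.Empty using (⊥)
open import Relation.Nullary using (¬_; contradiction)
open import Relation.Nullary.Decidable using (decidable-stable)
open import Relation.Binary.PropositionalEquality using (_≡_; _≢_; refl; sym; trans; subst)

open State

¬In∧¬Out⇒Un : ∀ {s} → s ≢ In → s ≢ Out → s ≡ Un
¬In∧¬Out⇒Un {Out} _ ¬Out = contradiction refl ¬Out
¬In∧¬Out⇒Un {In}  ¬In _  = contradiction refl ¬In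
¬In∧¬Out⇒Un {Un}  _ _    = refl

sings-0⇒In : ∀ {s l} → Sings s l 0 → s ≡ In
sings-0⇒In sing-in = refl

to-In-inv : ∀ {h0 hl s s'} → Transition h0 hl s s' → s' ≡ In →
  ¬ h0 × (s ≡ In ⊎ (s ≡ Un × ¬ hl))
to-In-inv (in-silent ¬h0)        refl = ¬h0 , inj₁ refl
to-In-inv (un-silent ¬h0 ¬hl)    refl = ¬h0 , inj₂ (refl , ¬hl)

to-Out⇒heard0 : ∀ {h0 hl s s'} → Transition h0 hl s s' → s' ≡ Out → h0
to-Out⇒heard0 (un-heard0 h0)  refl = h0
to-Out⇒heard0 (out-heard0 h0) refl = h0

In-silent⇒stays-In : ∀ {h0 hl s s'} → Transition h0 hl s s' → s ≡ In → ¬ h0 → s' ≡ In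
In-silent⇒stays-In (in-heard0 h0)  refl ¬h0 = contradiction h0 ¬h0
In-silent⇒stays-In (in-silent _)   refl _   = refl

to-Un-heard0⇒from-In : ∀ {h0 hl s s'} → Transition h0 hl s s' → s' ≡ Un → h0 → s ≡ In
to-Un-heard0⇒from-In (in-heard0 _)       refl _  = refl
to-Un-heard0⇒from-In (un-heardℓ ¬h0 _)   refl h0 = contradiction h0 ¬h0
to-Un-heard0⇒from-In (out-silent ¬h0)    refl h0 = contradiction h0 ¬h0

module _ {n : ℕ} (X : Execution n) where
  open Execution X

  adj-sym : ∀ {j a b} → Adj G j a b → Adj G j b a
  adj-sym {j} {a} {b} = proj₁ (simple j a b)

  hears-In-neighbour : ∀ {j a b} → Adj G j a b → st j b ≡ In → Hears G st ℓ j a 0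
  hears-In-neighbour {j} {b = b} a~b b∈In =
    b , a~b , subst (λ s → Sings s (ℓ j b) 0) (sym b∈In) sing-in

  heard0⇒In-neighbour : ∀ {j a} → Hears G st ℓ j a 0 → Σ (Fin n) λ b → Adj G j a b × st j b ≡ In
  heard0⇒In-neighbour (b , a~b , sings) = b , a~b , sings-0⇒In sings

  adjacent-Un-one-hears-own-note : ∀ {j a b} → Adj G j a b → st j a ≡ Un → st j b ≡ Un →
    Hears G st ℓ j a (ℓ j a) ⊎ Hears G st ℓ j b (ℓ j b)
  adjacent-Un-one-hears-own-note {j} {a} {b} a~b a∈Un b∈Un with ≤-total (ℓ j a) (ℓ j b)
  ... | inj₁ ℓa≤ℓb =
    inj₁ (b , a~b , subst (λ s → Sings s (ℓ j b) (ℓ j a)) (sym b∈Un) (sing-un (ℓ≥1 j a) ℓa≤ℓb))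
  ... | inj₂ ℓb≤ℓa =
    inj₂ (a , adj-sym a~b , subst (λ s → Sings s (ℓ j a) (ℓ j b)) (sym a∈Un) (sing-un (ℓ≥1 j b) ℓb≤ℓa))

  adjacent-not-both-In : ∀ {j a b} → Adj G j a b → R (suc j) a ≡ false → R (suc j) b ≡ false →
    st (suc j) a ≡ In → st (suc j) b ≡ In → ⊥
  adjacent-not-both-In {j} {a} {b} a~b a-obeys b-obeys a∈In b∈In
    with to-In-inv (follows j a a-obeys) a∈In | to-In-inv (follows j b b-obeys) b∈In
  ... | _ , inj₁ a∈In₀ | ¬b-h0 , _ = ¬b-h0 (hears-In-neighbour (adj-sym a~b) a∈In₀)
  ... | ¬a-h0 , _ | _ , inj₁ b∈In₀ = ¬a-h0 (hears-In-neighbour a~b b∈In₀)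
  ... | _ , inj₂ (a∈Un₀ , ¬a-hℓ) | _ , inj₂ (b∈Un₀ , ¬b-hℓ)
    with adjacent-Un-one-hears-own-note a~b a∈Un₀ b∈Un₀
  ... | inj₁ a-hℓ = ¬a-hℓ a-hℓ
  ... | inj₂ b-hℓ = ¬b-hℓ b-hℓ

  InNoIn⇒stays-In : ∀ {j u} → R (suc j) u ≡ false → InNoIn X j u → st (suc j) u ≡ In
  InNoIn⇒stays-In {j} {u} u-obeys (u∈In , no-In-nbr) =
    In-silent⇒stays-In (follows j u u-obeys) u∈In
      (λ h0 → let (x , u~x , x∈In) = heard0⇒In-neighbour h0 in no-In-nbr x u~x x∈In)

  unchanged⇒edges-stable : ∀ {k c} → ¬ ChangedIn X k c → ∀ x → G k c x ≡ G (suc k) c x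
  unchanged⇒edges-stable {k} {c} unchanged x =
    decidable-stable (G k c x ≟ G (suc k) c x) (λ differ → unchanged (x , inj₁ differ))

  unchanged⇒¬reinserted : ∀ {k c x} → ¬ ChangedIn X k c → Adj G (suc k) c x → R (suc k) c ≡ false
  unchanged⇒¬reinserted {x = x} unchanged c~x =
    ¬-not (λ reinserted → unchanged (x , inj₂ (inj₁ reinserted , inj₂ c~x)))

  unchanged⇒neighbour-¬reinserted : ∀ {k c x} → ¬ ChangedIn X k c → Adj G (suc k) c x →
    R (suc k) x ≡ false
  unchanged⇒neighbour-¬reinserted {x = x} unchanged c~x =
    ¬-not (λ reinserted → unchanged (x , inj₂ (inj₂ reinserted , inj₂ c~x)))

  unchanged-In⇒InNoIn : ∀ {k u} → ¬ ChangedIn X k u → st (suc k) u ≡ In → InNoIn X (suc k) u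
  unchanged-In⇒InNoIn unchanged u∈In = u∈In , λ x u~x x∈In →
    adjacent-not-both-In (trans (unchanged⇒edges-stable unchanged x) u~x)
      (unchanged⇒¬reinserted unchanged u~x) (unchanged⇒neighbour-¬reinserted unchanged u~x)
      u∈In x∈In

  record UnchangedAround (k : ℕ) (v : Fin n) : Set where
    field
      centre-unchanged    : ¬ ChangedIn X k v
      neighbour-unchanged : ∀ {u} → Adj G (suc k) v u → ¬ ChangedIn X k u

  open UnchangedAround

  unaffected⇒unchangedAround : ∀ {k v w} → Adj G (suc k) v w → ¬ AffectedIn X k v w →
    UnchangedAround k v
  unaffected⇒unchangedAround v~w unaffected = record
    { centre-unchanged    = λ changed → unaffected (v~w , _ , changed , inj₁ (inj₁ refl))
    ; neighbour-unchanged = λ v~u changed → unaffected (v~w , _ , changed , inj₁ (inj₂ (inj₁ v~u)))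
    }

  module _ {i : ℕ} {v : Fin n} (calm₁ : UnchangedAround i v) (calm₂ : UnchangedAround (suc i) v) where
    private
      forward₀ : ∀ {u} → Adj G (suc i) v u → ∀ {x} → Adj G i u x → Adj G (suc i) u x
      forward₀ v~u {x} = trans (sym (unchanged⇒edges-stable (neighbour-unchanged calm₁ v~u) x))

      forward₁ : ∀ {u} → Adj G (suc i) v u → Adj G (suc (suc i)) v u
      forward₁ {u} = trans (sym (unchanged⇒edges-stable (centre-unchanged calm₂) u))

      backward₁ : ∀ {u} → Adj G (suc (suc i)) v u → Adj G (suc i) v u
      backward₁ {u} = trans (unchanged⇒edges-stable (centre-unchanged calm₂) u)

    In-neighbour-stays-In : ∀ {u} → Adj G (suc i) v u → st (suc i) u ≡ In → st (suc (suc i)) u ≡ In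
    In-neighbour-stays-In v~u u∈In =
      InNoIn⇒stays-In (unchanged⇒neighbour-¬reinserted (centre-unchanged calm₂) (forward₁ v~u))
        (unchanged-In⇒InNoIn (neighbour-unchanged calm₁ v~u) u∈In)

    active⇒no-In-neighbour : Active X (suc (suc i)) v →
      ∀ u → Adj G (suc (suc i)) v u → st (suc (suc i)) u ≢ In
    active⇒no-In-neighbour active u v~u u∈In =
      active (inj₂ (u , v~u , unchanged-In⇒InNoIn (neighbour-unchanged calm₂ v~u) u∈In))

    heard0⇒In-neighbour-next-round : Hears G st ℓ (suc i) v 0 →
      Σ (Fin n) λ u → Adj G (suc (suc i)) v u × st (suc (suc i)) u ≡ In
    heard0⇒In-neighbour-next-round h0 with heard0⇒In-neighbour h0
    ... | u , v~u , u∈In = u , forward₁ v~u , In-neighbour-stays-In v~u u∈In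

    active⇒UnNoIn : ∀ {w} → Adj G (suc (suc i)) v w →
      Active X (suc (suc i)) v → UnNoIn X (suc (suc i)) v
    active⇒UnNoIn v~w active = ¬In∧¬Out⇒Un ¬In ¬Out , no-In-neighbour
      where
      no-In-neighbour : ∀ u → Adj G (suc (suc i)) v u → st (suc (suc i)) u ≢ In
      no-In-neighbour = active⇒no-In-neighbour active

      ¬In : st (suc (suc i)) v ≢ In
      ¬In v∈In = active (inj₁ (v∈In , no-In-neighbour))

      ¬Out : st (suc (suc i)) v ≢ Out
      ¬Out v∈Out with heard0⇒In-neighbour-next-round
        (to-Out⇒heard0 (follows (suc i) v (unchanged⇒¬reinserted (centre-unchanged calm₂) v~w)) v∈Out)
      ... | u , v~u , u∈In = no-In-neighbour u v~u u∈In

    Un-neighbour-was-active : ∀ {u} → Adj G (suc (suc i)) v u → st (suc (suc i)) u ≡ Un →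
      Active X i u
    Un-neighbour-was-active {u} v~u u∈Un (inj₁ u-InNoIn) = In≢Un (trans (sym u∈In₂) u∈Un)
      where
      v~u₁ : Adj G (suc i) v u
      v~u₁ = backward₁ v~u
      u∈In₁ : st (suc i) u ≡ In
      u∈In₁ =
        InNoIn⇒stays-In (unchanged⇒neighbour-¬reinserted (centre-unchanged calm₁) v~u₁) u-InNoIn
      u∈In₂ : st (suc (suc i)) u ≡ In
      u∈In₂ = In-neighbour-stays-In v~u₁ u∈In₁
      In≢Un : In ≢ Un
      In≢Un ()
    Un-neighbour-was-active {u} v~u u∈Un (inj₂ (y , u~y , y-InNoIn)) =
      proj₂ (unchanged-In⇒InNoIn u-unchanged₁ u∈In₁) y u~y₁ y∈In₁
      where
      v~u₁ : Adj G (suc i) v u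
      v~u₁ = backward₁ v~u
      u-unchanged₁ : ¬ ChangedIn X i u
      u-unchanged₁ = neighbour-unchanged calm₁ v~u₁
      u~y₁ : Adj G (suc i) u y
      u~y₁ = forward₀ v~u₁ u~y
      y∈In₁ : st (suc i) y ≡ In
      y∈In₁ = InNoIn⇒stays-In (unchanged⇒neighbour-¬reinserted u-unchanged₁ u~y₁) y-InNoIn
      u∈In₁ : st (suc i) u ≡ In
      u∈In₁ = to-Un-heard0⇒from-In
        (follows (suc i) u (unchanged⇒neighbour-¬reinserted (centre-unchanged calm₂) v~u))
        u∈Un (hears-In-neighbour u~y₁ y∈In₁)

lemma3 : ∀ {n} (X : Execution n) (i : ℕ) (v w : Fin n) →
    Adj (Execution.G X) (suc i) v w →
    Adj (Execution.G X) (suc (suc i)) v w →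
    ¬ AffectedIn X i v w →
    ¬ AffectedIn X (suc i) v w →
    (Active X (suc (suc i)) v → UnNoIn X (suc (suc i)) v) ×
    (∀ u → Adj (Execution.G X) (suc (suc i)) v u →
      Execution.st X (suc (suc i)) u ≡ State.Un → Active X i u)
lemma3 X i v w v~w₁ v~w₂ unaffected₁ unaffected₂ =
  active⇒UnNoIn X calm₁ calm₂ v~w₂ , λ u → Un-neighbour-was-active X calm₁ calm₂
  where
  calm₁ : UnchangedAround X i v
  calm₁ = unaffected⇒unchangedAround X v~w₁ unaffected₁
  calm₂ : UnchangedAround X (suc i) v
  calm₂ = unaffected⇒unchangedAround X v~w₂ unaffected₂
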